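{- For all integers $n,k,h$ with $2\leqslant k\leqslant n-1$ and $0\leqslant h\leqslant n-k$, $S_{n,k}$ has an $h$-cut of cardinality $n+h(k-2)-1$; that is, $\kappa_s^{(h)}(S_{n,k})\leqslant n+h(k-2)-1$.
   Context: Let $I_n=\{1,\ldots,n\}$ and for $1\leqslant k\leqslant n-1$ let $P(n,k)$ be the set of $k$-permutations $p_1p_2\cdots p_k$ of distinct elements of $I_n$. The $(n,k)$-star graph $S_{n,k}$ has vertex set $P(n,k)$, and a vertex $p=p_1p_2\cdots p_k$ is adjacent to (a) $p_ip_2\cdots p_{i-1}p_1p_{i+1}\cdots p_k$ for each $2\leqslant i\leqslant k$ (swap-edges), and (b) $\alpha p_2\cdots p_k$ for each $\alpha\in I_n\setminus\{p_1,\ldots,p_k\}$ (unswap-edges). For a connected graph $G$ and integer $h\geqslant 0$, a set $S\subseteq V(G)$ is an $h$-cut if $G-S$ is disconnected and has minimum degree at least $h$; $\kappa_s^{(h)}(G)$ is the minimum cardinality of an $h$-cut of $G$. -}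

module Defs where

open import Data.Nat using (ℕ; zero; suc)
open import Data.Fin using (Fin; toℕ)
open import Data.Vec using (Vec; lookup; _[_]≔_)
open import Data.List using (List; length)
open import Data.List.Membership.Propositional using (_∈_; _∉_)
open import Data.List.Relation.Unary.All using (All)
open import Data.List.Relation.Unary.Unique.Propositional using (Unique)
open import Data.Product using (Σ; ∃; _×_; _,_)
open import Data.Sum using (_⊎_)
open import Relation.Binary.PropositionalEquality using (_≡_; _≢_)
open import Relation.Nullary using (¬_)

Word : ℕ → ℕ → Set
Word n k = Vec (Fin n) k

IsVertex : {n k : ℕ} → Word n k → Set
IsVertex {n} {k} p = (i j : Fin k) → lookup p i ≡ lookup p j → i ≡ j

SwapEdge : {n k : ℕ} → Word n k → Word n k → Set
SwapEdge {n} {k} p q =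
  Σ (Fin k) λ f → Σ (Fin k) λ i →
    toℕ f ≡ 0 × toℕ i ≢ 0 × q ≡ ((p [ f ]≔ lookup p i) [ i ]≔ lookup p f)

UnswapEdge : {n k : ℕ} → Word n k → Word n k → Set
UnswapEdge {n} {k} p q =
  Σ (Fin k) λ f → Σ (Fin n) λ α →
    toℕ f ≡ 0 × ((j : Fin k) → lookup p j ≢ α) × q ≡ (p [ f ]≔ α)

Adj : {n k : ℕ} → Word n k → Word n k → Set
Adj p q = SwapEdge p q ⊎ UnswapEdge p q

InRest : {n k : ℕ} → List (Word n k) → Word n k → Set
InRest S v = IsVertex v × v ∉ S

data Reach {n k : ℕ} (S : List (Word n k)) : Word n k → Word n k → Set where
  here : ∀ {u} → InRest S u → Reach S u u
  step : ∀ {u v w} → InRest S u → Adj u v → Reach S v w → Reach S u w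

Disconnected : {n k : ℕ} → List (Word n k) → Set
Disconnected {n} {k} S =
  Σ (Word n k) λ u → Σ (Word n k) λ v →
    InRest S u × InRest S v × ¬ Reach S u v

MinDegreeAtLeast : {n k : ℕ} → ℕ → List (Word n k) → Set
MinDegreeAtLeast {n} {k} h S =
  (v : Word n k) → InRest S v →
    Σ (List (Word n k)) λ N →
      Unique N × length N ≡ h × All (λ w → InRest S w × Adj v w) N

IsHCut : {n k : ℕ} → ℕ → List (Word n k) → Set
IsHCut h S = All IsVertex S × Unique S × Disconnected S × MinDegreeAtLeast h S

-- Write k = K + 1 and split the n symbols into a tail alphabet T = {τ₁,…,τ_K},
-- a set A of h + 1 symbols and the remaining set B of n − k − h symbols; put
-- t = τ₁⋯τ_K.  The words a t (a ∈ A) form a clique K_{h+1} of S_{n,k}.  Its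
-- neighbours outside the clique are the words b t (b ∈ B) and the swap-neighbours
-- τ_j (t with τ_j replaced by a), (n − k − h) + (h + 1)(k − 1) = n + h(k − 2) − 1
-- vertices in all; deleting them cuts off the clique, whose vertices keep degree h.
-- Every other surviving vertex keeps at least h neighbours: if its tail is neither
-- t nor some t[τ_j := a] it keeps all n − k unswap-neighbours, and if its tail is
-- t[τ_j := a] it keeps its swap-neighbour at position j together with every
-- unswap-neighbour except the one with head τ_j.
module Submission where

open import Data.Nat using (ℕ; zero; suc; _+_; _*_; _∸_; _≤_; z≤n; s≤s)
open import Data.Nat.Properties
  using (≤-reflexive; ≤-pred; +-comm; +-suc; +-identityʳ; +-monoˡ-≤; +-cancelʳ-≤; m+n≤o⇒m≤o; m≤n⇒m≤1+n;
         m≤n⇒m⊓n≡m; m+[n∸m]≡n; +-∸-assoc; m∸n+n≡m; module ≤-Reasoning)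
open import Data.Nat.Tactic.RingSolver using (solve-∀)
open import Data.Fin using (Fin; zero; suc; _↑ˡ_; _↑ʳ_)
open import Data.Fin.Properties using (↑ˡ-injective; ↑ʳ-injective; 0≢1+n; any?)
  renaming (_≟_ to _≟ᶠ_; suc-injective to suc-injectiveᶠ)
open import Data.Vec using (Vec; []; _∷_; lookup; _[_]≔_; tabulate)
open import Data.Vec.Properties
  using (lookup∘update; lookup∘update′; lookup∘tabulate; ∷-injectiveˡ; ∷-injectiveʳ; ≡-dec)
open import Data.List using (List; []; _∷_; length; filter; take; map; _++_; allFin; cartesianProduct)
open import Data.List.Properties using (length-map; length-++; length-tabulate; length-take; filter-all)
open import Data.List.Membership.Propositional using (_∈_; _∉_)
open import Data.List.Membership.Propositional.Properties
  using (∈-map⁻; ∈-map⁺; ∈-++⁻; ∈-++⁺ˡ; ∈-++⁺ʳ; ∈-allFin; ∈-filter⁻; ∈-cartesianProduct⁺)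
open import Data.List.Relation.Unary.All as All using (All; _∷_)
open import Data.List.Relation.Unary.All.Properties using (take⁺)
open import Data.List.Relation.Unary.AllPairs using (_∷_)
open import Data.List.Relation.Unary.Unique.Propositional using (Unique)
import Data.List.Relation.Unary.Unique.Propositional.Properties as Unique
open import Data.Product using (Σ; ∃; _×_; _,_; proj₁; proj₂; uncurry)
open import Data.Sum using (_⊎_; inj₁; inj₂)
open import Data.Empty using (⊥-elim)
open import Function using (_∘_)
open import Relation.Binary.PropositionalEquality
open import Relation.Nullary using (¬_; Dec; yes; no; ¬?)

open import Defs

data Split (m n : ℕ) : Fin (m + n) → Set where
  left  : (i : Fin m) → Split m n (i ↑ˡ n)
  right : (j : Fin n) → Split m n (m ↑ʳ j)

split : ∀ m n (i : Fin (m + n)) → Split m n i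
split zero    n i       = right i
split (suc m) n zero    = left zero
split (suc m) n (suc i) with split m n i
... | left i′ = left (suc i′)
... | right j = right j

↑ˡ≢↑ʳ : ∀ {m n} (i : Fin m) (j : Fin n) → i ↑ˡ n ≢ m ↑ʳ j
↑ˡ≢↑ʳ zero    j ()
↑ˡ≢↑ʳ (suc i) j eq = ↑ˡ≢↑ʳ i j (suc-injectiveᶠ eq)

length-allFin : ∀ n → length (allFin n) ≡ n
length-allFin n = length-tabulate {n = n} (λ i → i)

length-cartesianProduct : ∀ {A B : Set} (xs : List A) (ys : List B) →
  length (cartesianProduct xs ys) ≡ length xs * length ys
length-cartesianProduct []       ys = refl
length-cartesianProduct (x ∷ xs) ys = begin
  length (map (x ,_) ys ++ cartesianProduct xs ys)       ≡⟨ length-++ (map (x ,_) ys) ⟩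
  length (map (x ,_) ys) + length (cartesianProduct xs ys) ≡⟨ cong₂ _+_ (length-map (x ,_) ys)
                                                               (length-cartesianProduct xs ys) ⟩
  length ys + length xs * length ys                        ∎
  where open ≡-Reasoning

take-exactly : ∀ {A : Set} {P : A → Set} h {L : List A} → Unique L → h ≤ length L → All P L →
  Σ (List A) λ L′ → Unique L′ × length L′ ≡ h × All P L′
take-exactly h {L} uL h≤ pL =
  take h L , Unique.take⁺ h uL , trans (length-take h L) (m≤n⇒m⊓n≡m h≤) , take⁺ h pL

module _ {N : ℕ} where

  _≢?_ : (y β : Fin N) → Dec (y ≢ β)
  y ≢? β = ¬? (y ≟ᶠ β)

  freshSymbols : ∀ {m} → Vec (Fin N) m → List (Fin N)
  freshSymbols []       = allFin N
  freshSymbols (y ∷ ys) = filter (y ≢?_) (freshSymbols ys)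

  ∈-freshSymbols⁻ : ∀ {m} (ws : Vec (Fin N) m) {β} → β ∈ freshSymbols ws →
    (j : Fin m) → lookup ws j ≢ β
  ∈-freshSymbols⁻ (y ∷ ys) β∈ zero    = proj₂ (∈-filter⁻ (y ≢?_) {xs = freshSymbols ys} β∈)
  ∈-freshSymbols⁻ (y ∷ ys) β∈ (suc j) =
    ∈-freshSymbols⁻ ys (proj₁ (∈-filter⁻ (y ≢?_) {xs = freshSymbols ys} β∈)) j

  freshSymbols-unique : ∀ {m} (ws : Vec (Fin N) m) → Unique (freshSymbols ws)
  freshSymbols-unique []       = Unique.allFin⁺ N
  freshSymbols-unique (y ∷ ys) = Unique.filter⁺ (y ≢?_) (freshSymbols-unique ys)

  length-filter-≢ : ∀ y {L : List (Fin N)} → Unique L → length L ≤ suc (length (filter (y ≢?_) L))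
  length-filter-≢ y {[]}    _           = z≤n
  length-filter-≢ y {z ∷ L} (z∉L ∷ uL) with y ≟ᶠ z
  ... | yes refl = s≤s (≤-reflexive (sym (cong length (filter-all (y ≢?_) z∉L))))
  ... | no _     = s≤s (length-filter-≢ y uL)

  length-freshSymbols : ∀ {m} (ws : Vec (Fin N) m) → N ≤ length (freshSymbols ws) + m
  length-freshSymbols [] = ≤-reflexive (trans (sym (length-allFin N)) (sym (+-identityʳ _)))
  length-freshSymbols {suc m} (y ∷ ys) = begin
    N                                        ≤⟨ length-freshSymbols ys ⟩
    length (freshSymbols ys) + m             ≤⟨ +-monoˡ-≤ m (length-filter-≢ y (freshSymbols-unique ys)) ⟩
    suc (length (freshSymbols (y ∷ ys))) + m ≡⟨ +-suc _ m ⟨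
    length (freshSymbols (y ∷ ys)) + suc m   ∎
    where open ≤-Reasoning

module _ {N K : ℕ} {x : Fin N} {xs : Vec (Fin N) K} where

  private
    lookup-update-cases : (j i : Fin K) →
      (i ≡ j × lookup (xs [ j ]≔ x) i ≡ x) ⊎ (i ≢ j × lookup (xs [ j ]≔ x) i ≡ lookup xs i)
    lookup-update-cases j i with i ≟ᶠ j
    ... | yes refl = inj₁ (refl , lookup∘update i xs x)
    ... | no i≢j   = inj₂ (i≢j , lookup∘update′ i≢j xs x)

  IsVertex-swap : IsVertex (x ∷ xs) → (j : Fin K) → IsVertex (lookup xs j ∷ (xs [ j ]≔ x))
  IsVertex-swap V j zero    zero    eq = refl
  IsVertex-swap V j zero    (suc i) eq with lookup-update-cases j i
  ... | inj₁ (refl , e) = ⊥-elim (0≢1+n (sym (V (suc j) zero (trans eq e))))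
  ... | inj₂ (i≢j , e)  = ⊥-elim (i≢j (sym (suc-injectiveᶠ (V (suc j) (suc i) (trans eq e)))))
  IsVertex-swap V j (suc i) zero    eq with lookup-update-cases j i
  ... | inj₁ (refl , e) = ⊥-elim (0≢1+n (sym (V (suc j) zero (trans (sym eq) e))))
  ... | inj₂ (i≢j , e)  = ⊥-elim (i≢j (suc-injectiveᶠ (V (suc i) (suc j) (trans (sym e) eq))))
  IsVertex-swap V j (suc i) (suc i′) eq with lookup-update-cases j i | lookup-update-cases j i′
  ... | inj₁ (refl , _)  | inj₁ (refl , _)  = refl
  ... | inj₁ (refl , e₁) | inj₂ (_ , e₂)    = ⊥-elim (0≢1+n (V zero (suc i′) (trans (sym e₁) (trans eq e₂))))
  ... | inj₂ (_ , e₁)    | inj₁ (refl , e₂) = ⊥-elim (0≢1+n (sym (V (suc i) zero (trans (sym e₁) (trans eq e₂)))))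
  ... | inj₂ (_ , e₁)    | inj₂ (_ , e₂)    = V (suc i) (suc i′) (trans (sym e₁) (trans eq e₂))

  IsVertex-replaceHead : ∀ {β} → ((i : Fin (suc K)) → lookup (x ∷ xs) i ≢ β) →
    IsVertex (x ∷ xs) → IsVertex (β ∷ xs)
  IsVertex-replaceHead fresh V zero    zero    eq = refl
  IsVertex-replaceHead fresh V zero    (suc j) eq = ⊥-elim (fresh (suc j) (sym eq))
  IsVertex-replaceHead fresh V (suc i) zero    eq = ⊥-elim (fresh (suc i) eq)
  IsVertex-replaceHead fresh V (suc i) (suc j) eq = V (suc i) (suc j) eq

module _ {N K : ℕ} (xs : Vec (Fin N) K) where

  headReplacements : ∀ {m} → Vec (Fin N) m → List (Word N (suc K))
  headReplacements ws = map (_∷ xs) (freshSymbols ws)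

  headReplacements-unique : ∀ {m} (ws : Vec (Fin N) m) → Unique (headReplacements ws)
  headReplacements-unique ws = Unique.map⁺ ∷-injectiveˡ (freshSymbols-unique ws)

  length-headReplacements : ∀ {m} (ws : Vec (Fin N) m) → N ≤ length (headReplacements ws) + m
  length-headReplacements {m} ws =
    subst (λ l → N ≤ l + m) (sym (length-map (_∷ xs) (freshSymbols ws))) (length-freshSymbols ws)

  ∈-headReplacements⁻ : ∀ {m} (ws : Vec (Fin N) m) {w} → w ∈ headReplacements ws →
    ∃ λ β → ((j : Fin m) → lookup ws j ≢ β) × w ≡ β ∷ xs
  ∈-headReplacements⁻ ws w∈ with ∈-map⁻ (_∷ xs) w∈
  ... | β , β∈ , refl = β , ∈-freshSymbols⁻ ws β∈ , refl

Reach-start : ∀ {n k} {S : List (Word n k)} {u w} → Reach S u w → InRest S u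
Reach-start (here u∈)     = u∈
Reach-start (step u∈ _ _) = u∈

RestNeighboursAtLeast : {n k : ℕ} → ℕ → List (Word n k) → Word n k → Set
RestNeighboursAtLeast {n} {k} h S v =
  Σ (List (Word n k)) λ L → Unique L × h ≤ length L × All (λ w → InRest S w × Adj v w) L

minDegreeAtLeast : ∀ {n k h} {S : List (Word n k)} →
  ((v : Word n k) → InRest S v → RestNeighboursAtLeast h S v) → MinDegreeAtLeast h S
minDegreeAtLeast {h = h} many v v∈ with many v v∈
... | L , uL , h≤ , good = take-exactly h uL h≤ good

-- The alphabet Fin (suc h + e + K) is read as A ⊎ B ⊎ T with |A| = h + 1, |B| = e and
-- T = {τ₁,…,τ_K}; swapped a j is the swap-neighbour of a t at position j + 1.
module Construction (h e K : ℕ) where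

  N : ℕ
  N = suc h + e + K

  Sym : Set
  Sym = Fin N

  W : Set
  W = Word N (suc K)

  symA : Fin (suc h) → Sym
  symA a = (a ↑ˡ e) ↑ˡ K

  symB : Fin e → Sym
  symB b = (suc h ↑ʳ b) ↑ˡ K

  symT : Fin K → Sym
  symT j = (suc h + e) ↑ʳ j

  data SymView : Sym → Set where
    isA : ∀ a → SymView (symA a)
    isB : ∀ b → SymView (symB b)
    isT : ∀ j → SymView (symT j)

  symView : ∀ c → SymView c
  symView c with split (suc h + e) K c
  ... | right j = isT j
  ... | left c′ with split (suc h) e c′
  ...   | left a  = isA a
  ...   | right b = isB b

  symA≢symT : ∀ a j → symA a ≢ symT j
  symA≢symT a j = ↑ˡ≢↑ʳ (a ↑ˡ e) j

  symB≢symT : ∀ b j → symB b ≢ symT j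
  symB≢symT b j = ↑ˡ≢↑ʳ (suc h ↑ʳ b) j

  symA≢symB : ∀ a b → symA a ≢ symB b
  symA≢symB a b eq = ↑ˡ≢↑ʳ a b (↑ˡ-injective K _ _ eq)

  symA-injective : ∀ {a a′} → symA a ≡ symA a′ → a ≡ a′
  symA-injective eq = ↑ˡ-injective e _ _ (↑ˡ-injective K _ _ eq)

  symB-injective : ∀ {b b′} → symB b ≡ symB b′ → b ≡ b′
  symB-injective eq = ↑ʳ-injective (suc h) _ _ (↑ˡ-injective K _ _ eq)

  symT-injective : ∀ {j j′} → symT j ≡ symT j′ → j ≡ j′
  symT-injective = ↑ʳ-injective (suc h + e) _ _

  tail : Vec Sym K
  tail = tabulate symT

  lookup-tail : ∀ j → lookup tail j ≡ symT j
  lookup-tail = lookup∘tabulate symT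

  withTail : Sym → W
  withTail c = c ∷ tail

  swapped : Fin (suc h) → Fin K → W
  swapped a j = symT j ∷ (tail [ j ]≔ symA a)

  lookup-swappedTail : ∀ a j → lookup (tail [ j ]≔ symA a) j ≡ symA a
  lookup-swappedTail a j = lookup∘update j tail (symA a)

  swappedTail≢tail : ∀ a j → tail [ j ]≔ symA a ≢ tail
  swappedTail≢tail a j eq =
    symA≢symT a j (trans (sym (lookup-swappedTail a j)) (trans (cong (λ v → lookup v j) eq) (lookup-tail j)))

  swappedTail-position : ∀ {a a′ j j′} → tail [ j ]≔ symA a ≡ tail [ j′ ]≔ symA a′ → j ≡ j′
  swappedTail-position {a} {a′} {j} {j′} eq with j ≟ᶠ j′
  ... | yes j≡j′ = j≡j′
  ... | no j≢j′  = ⊥-elim (symA≢symT a j (begin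
    symA a                          ≡⟨ lookup-swappedTail a j ⟨
    lookup (tail [ j ]≔ symA a) j   ≡⟨ cong (λ v → lookup v j) eq ⟩
    lookup (tail [ j′ ]≔ symA a′) j ≡⟨ lookup∘update′ j≢j′ tail (symA a′) ⟩
    lookup tail j                   ≡⟨ lookup-tail j ⟩
    symT j                          ∎))
    where open ≡-Reasoning

  swapIndices : List (Fin (suc h) × Fin K)
  swapIndices = cartesianProduct (allFin (suc h)) (allFin K)

  cutB cutSwapped cut : List W
  cutB       = map (withTail ∘ symB) (allFin e)
  cutSwapped = map (uncurry swapped) swapIndices
  cut        = cutB ++ cutSwapped

  withTail-symB∈cut : ∀ b → withTail (symB b) ∈ cut
  withTail-symB∈cut b = ∈-++⁺ˡ (∈-map⁺ (withTail ∘ symB) (∈-allFin b))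

  swapped∈cut : ∀ a j → swapped a j ∈ cut
  swapped∈cut a j =
    ∈-++⁺ʳ cutB (∈-map⁺ (uncurry swapped) (∈-cartesianProduct⁺ (∈-allFin a) (∈-allFin j)))

  InCut : W → Set
  InCut w = (∃ λ b → w ≡ withTail (symB b)) ⊎ (∃ λ a → ∃ λ j → w ≡ swapped a j)

  ∈-cut⁻ : ∀ {w} → w ∈ cut → InCut w
  ∈-cut⁻ w∈ with ∈-++⁻ cutB w∈
  ... | inj₁ w∈B with ∈-map⁻ (withTail ∘ symB) w∈B
  ...   | b , _ , eq = inj₁ (b , eq)
  ∈-cut⁻ w∈ | inj₂ w∈S with ∈-map⁻ (uncurry swapped) w∈S
  ...   | (a , j) , _ , eq = inj₂ (a , j , eq)

  IsVertex-withTail : ∀ c → (∀ j → c ≢ symT j) → IsVertex (withTail c)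
  IsVertex-withTail c c∉T zero    zero    eq = refl
  IsVertex-withTail c c∉T zero    (suc j) eq = ⊥-elim (c∉T j (trans eq (lookup-tail j)))
  IsVertex-withTail c c∉T (suc i) zero    eq = ⊥-elim (c∉T i (trans (sym eq) (lookup-tail i)))
  IsVertex-withTail c c∉T (suc i) (suc j) eq =
    cong suc (symT-injective (trans (sym (lookup-tail i)) (trans eq (lookup-tail j))))

  IsVertex-swapped : ∀ a j → IsVertex (swapped a j)
  IsVertex-swapped a j =
    subst (λ c → IsVertex (c ∷ (tail [ j ]≔ symA a))) (lookup-tail j)
      (IsVertex-swap (IsVertex-withTail (symA a) (symA≢symT a)) j)

  IsVertex-cut : All IsVertex cut
  IsVertex-cut = All.tabulate (IsVertex-InCut ∘ ∈-cut⁻)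
    where
    IsVertex-InCut : ∀ {w} → InCut w → IsVertex w
    IsVertex-InCut (inj₁ (b , refl))     = IsVertex-withTail (symB b) (symB≢symT b)
    IsVertex-InCut (inj₂ (a , j , refl)) = IsVertex-swapped a j

  swapped-injective : ∀ {p q} → uncurry swapped p ≡ uncurry swapped q → p ≡ q
  swapped-injective {a , j} {a′ , j′} eq with symT-injective (∷-injectiveˡ eq)
  ... | refl = cong (_, j) (symA-injective (begin
    symA a                          ≡⟨ lookup-swappedTail a j ⟨
    lookup (tail [ j ]≔ symA a) j   ≡⟨ cong (λ v → lookup v j) (∷-injectiveʳ eq) ⟩
    lookup (tail [ j ]≔ symA a′) j  ≡⟨ lookup-swappedTail a′ j ⟩
    symA a′                         ∎))
    where open ≡-Reasoning

  cut-unique : Unique cut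
  cut-unique = Unique.++⁺
    (Unique.map⁺ (symB-injective ∘ ∷-injectiveˡ) (Unique.allFin⁺ e))
    (Unique.map⁺ swapped-injective (Unique.cartesianProduct⁺ (Unique.allFin⁺ _) (Unique.allFin⁺ _)))
    disjoint
    where
    disjoint : ∀ {w} → ¬ (w ∈ cutB × w ∈ cutSwapped)
    disjoint (w∈B , w∈S) with ∈-map⁻ (withTail ∘ symB) w∈B | ∈-map⁻ (uncurry swapped) w∈S
    ... | b , _ , refl | (_ , j) , _ , eq = symB≢symT b j (∷-injectiveˡ eq)

  length-cut : length cut ≡ e + suc h * K
  length-cut = begin
    length (cutB ++ cutSwapped)
      ≡⟨ length-++ cutB ⟩
    length cutB + length cutSwapped
      ≡⟨ cong₂ _+_ (length-map (withTail ∘ symB) (allFin e)) (length-map (uncurry swapped) swapIndices) ⟩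
    length (allFin e) + length swapIndices
      ≡⟨ cong₂ _+_ (length-allFin e) (length-cartesianProduct (allFin (suc h)) (allFin K)) ⟩
    e + length (allFin (suc h)) * length (allFin K)
      ≡⟨ cong₂ (λ p q → e + p * q) (length-allFin (suc h)) (length-allFin K) ⟩
    e + suc h * K
      ∎
    where open ≡-Reasoning

  IsClique : W → Set
  IsClique w = ∃ λ a → w ≡ withTail (symA a)

  withTail-symA∉cut : ∀ a → withTail (symA a) ∉ cut
  withTail-symA∉cut a w∈ with ∈-cut⁻ w∈
  ... | inj₁ (b , eq)     = symA≢symB a b (∷-injectiveˡ eq)
  ... | inj₂ (_ , j , eq) = symA≢symT a j (∷-injectiveˡ eq)

  InRest-withTail-symA : ∀ a → InRest cut (withTail (symA a))
  InRest-withTail-symA a = IsVertex-withTail (symA a) (symA≢symT a) , withTail-symA∉cut a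

  IsClique-adj : ∀ {a w} → InRest cut w → Adj (withTail (symA a)) w → IsClique w
  IsClique-adj w∈ (inj₁ (zero , zero , _ , j≢0 , _)) = ⊥-elim (j≢0 refl)
  IsClique-adj {a} w∈ (inj₁ (zero , suc j , _ , _ , refl)) =
    ⊥-elim (proj₂ w∈ (subst (λ c → c ∷ (tail [ j ]≔ symA a) ∈ cut)
                             (sym (lookup-tail j)) (swapped∈cut a j)))
  IsClique-adj w∈ (inj₂ (zero , β , _ , fresh , refl)) with symView β
  ... | isT j  = ⊥-elim (fresh (suc j) (lookup-tail j))
  ... | isB b  = ⊥-elim (proj₂ w∈ (withTail-symB∈cut b))
  ... | isA a′ = a′ , refl

  IsClique-reach : ∀ {u w} → Reach cut u w → IsClique u → IsClique w
  IsClique-reach (here _)        u∈C        = u∈C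
  IsClique-reach (step _ adj r) (_ , refl) = IsClique-reach r (IsClique-adj (Reach-start r) adj)

  -- γ t[τ_j := a₀], for a symbol γ ∈ (A ∪ B) ∖ {a₀}, survives the cut but is not in the clique.
  disconnected : Fin K → Fin (h + e) → Disconnected cut
  disconnected j c = withTail (symA zero) , outsider , InRest-withTail-symA zero ,
    (IsVertex-outsider , outsider∉cut) , λ r → outsider∉C (IsClique-reach r (zero , refl))
    where
    γ : Sym
    γ = suc c ↑ˡ K

    outsider : W
    outsider = γ ∷ (tail [ j ]≔ symA zero)

    IsVertex-outsider : IsVertex outsider
    IsVertex-outsider = IsVertex-replaceHead γ-fresh (IsVertex-swapped zero j)
      where
      γ-fresh : ∀ i → lookup (swapped zero j) i ≢ γ
      γ-fresh zero    eq = ↑ˡ≢↑ʳ (suc c) j (sym eq)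
      γ-fresh (suc i) eq with i ≟ᶠ j
      ... | yes refl = 0≢1+n (↑ˡ-injective K zero (suc c) (trans (sym (lookup-swappedTail zero i)) eq))
      ... | no i≢j   = ↑ˡ≢↑ʳ (suc c) i (sym (begin
        symT i                            ≡⟨ lookup-tail i ⟨
        lookup tail i                     ≡⟨ lookup∘update′ i≢j tail (symA zero) ⟨
        lookup (tail [ j ]≔ symA zero) i  ≡⟨ eq ⟩
        γ                                 ∎))
        where open ≡-Reasoning

    outsider∉cut : outsider ∉ cut
    outsider∉cut w∈ with ∈-cut⁻ w∈
    ... | inj₁ (_ , eq)      = swappedTail≢tail zero j (∷-injectiveʳ eq)
    ... | inj₂ (_ , j′ , eq) = ↑ˡ≢↑ʳ (suc c) j′ (∷-injectiveˡ eq)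

    outsider∉C : ¬ IsClique outsider
    outsider∉C (_ , eq) = swappedTail≢tail zero j (∷-injectiveʳ eq)

  N≤c+k⇒h≤c : ∀ c → N ≤ c + suc K → h ≤ c
  N≤c+k⇒h≤c c N≤ =
    m+n≤o⇒m≤o h (+-cancelʳ-≤ (suc K) (h + e) c (subst (_≤ c + suc K) (sym (+-suc (h + e) K)) N≤))

  restNeighbours-withTail : ∀ x → InRest cut (withTail x) → RestNeighboursAtLeast h cut (withTail x)
  restNeighbours-withTail x v∈ with symView x
  ... | isT j = ⊥-elim (0≢1+n (proj₁ v∈ zero (suc j) (sym (lookup-tail j))))
  ... | isB b = ⊥-elim (proj₂ v∈ (withTail-symB∈cut b))
  ... | isA a = map (withTail ∘ symA) others ,
    Unique.map⁺ (symA-injective ∘ ∷-injectiveˡ) (freshSymbols-unique (a ∷ [])) ,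
    subst (h ≤_) (sym (length-map (withTail ∘ symA) others))
      (≤-pred (subst (suc h ≤_) (+-comm _ 1) (length-freshSymbols (a ∷ [])))) ,
    All.tabulate neighbour
    where
    others : List (Fin (suc h))
    others = freshSymbols (a ∷ [])

    neighbour : ∀ {w} → w ∈ map (withTail ∘ symA) others → InRest cut w × Adj (withTail (symA a)) w
    neighbour w∈ with ∈-map⁻ (withTail ∘ symA) w∈
    ... | a′ , a′∈ , refl = InRest-withTail-symA a′ , inj₂ (zero , symA a′ , refl , fresh , refl)
      where
      fresh : ∀ i → lookup (withTail (symA a)) i ≢ symA a′
      fresh zero    eq = ∈-freshSymbols⁻ (a ∷ []) a′∈ zero (symA-injective eq)
      fresh (suc j) eq = symA≢symT a′ j (sym (trans (sym (lookup-tail j)) eq))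

  restNeighbours-swappedTail : ∀ x a j → let v = x ∷ (tail [ j ]≔ symA a) in
    InRest cut v → RestNeighboursAtLeast h cut v
  restNeighbours-swappedTail x a j v∈ =
    swapNeighbour ∷ unswaps ,
    All.tabulate swapNeighbour∉unswaps ∷ headReplacements-unique xs avoided ,
    N≤c+k⇒h≤c (suc (length unswaps))
      (subst (N ≤_) (+-suc _ (suc K)) (length-headReplacements xs avoided)) ,
    ((IsVertex-swap (proj₁ v∈) j , swapNeighbour∉cut) , inj₁ (zero , suc j , refl , (λ ()) , refl)) ∷
    All.tabulate unswapNeighbour
    where
    xs : Vec Sym K
    xs = tail [ j ]≔ symA a

    -- Head τ_j is excluded: τ_j ∷ xs is the cut vertex swapped a j.
    avoided : Vec Sym (suc (suc K))
    avoided = symT j ∷ x ∷ xs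

    unswaps : List W
    unswaps = headReplacements xs avoided

    swapNeighbour : W
    swapNeighbour = lookup xs j ∷ (xs [ j ]≔ x)

    swapNeighbour∉unswaps : ∀ {w} → w ∈ unswaps → swapNeighbour ≢ w
    swapNeighbour∉unswaps w∈ eq with ∈-headReplacements⁻ xs avoided w∈
    ... | β , fresh , refl = fresh (suc (suc j)) (∷-injectiveˡ eq)

    swapNeighbour∉cut : swapNeighbour ∉ cut
    swapNeighbour∉cut w∈ with ∈-cut⁻ w∈
    ... | inj₁ (b , eq)      = symA≢symB a b (trans (sym (lookup-swappedTail a j)) (∷-injectiveˡ eq))
    ... | inj₂ (_ , j′ , eq) = symA≢symT a j′ (trans (sym (lookup-swappedTail a j)) (∷-injectiveˡ eq))

    unswapNeighbour : ∀ {w} → w ∈ unswaps → InRest cut w × Adj (x ∷ xs) w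
    unswapNeighbour w∈ with ∈-headReplacements⁻ xs avoided w∈
    ... | β , fresh , refl =
      (IsVertex-replaceHead (fresh ∘ suc) (proj₁ v∈) , β∷xs∉cut) ,
      inj₂ (zero , β , refl , fresh ∘ suc , refl)
      where
      β∷xs∉cut : β ∷ xs ∉ cut
      β∷xs∉cut w∈ with ∈-cut⁻ w∈
      ... | inj₁ (_ , eq) = swappedTail≢tail a j (∷-injectiveʳ eq)
      ... | inj₂ (_ , _ , eq) with swappedTail-position (∷-injectiveʳ eq)
      ...   | refl = fresh zero (sym (∷-injectiveˡ eq))

  restNeighbours-otherTail : ∀ x xs → InRest cut (x ∷ xs) →
    xs ≢ tail → (∀ a j → xs ≢ tail [ j ]≔ symA a) → RestNeighboursAtLeast h cut (x ∷ xs)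
  restNeighbours-otherTail x xs v∈ xs≢tail xs≢swapped =
    headReplacements xs (x ∷ xs) ,
    headReplacements-unique xs (x ∷ xs) ,
    N≤c+k⇒h≤c _ (length-headReplacements xs (x ∷ xs)) ,
    All.tabulate unswapNeighbour
    where
    unswapNeighbour : ∀ {w} → w ∈ headReplacements xs (x ∷ xs) → InRest cut w × Adj (x ∷ xs) w
    unswapNeighbour w∈ with ∈-headReplacements⁻ xs (x ∷ xs) w∈
    ... | β , fresh , refl =
      (IsVertex-replaceHead fresh (proj₁ v∈) , β∷xs∉cut) , inj₂ (zero , β , refl , fresh , refl)
      where
      β∷xs∉cut : β ∷ xs ∉ cut
      β∷xs∉cut w∈ with ∈-cut⁻ w∈
      ... | inj₁ (_ , eq)     = xs≢tail (∷-injectiveʳ eq)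
      ... | inj₂ (a , j , eq) = xs≢swapped a j (∷-injectiveʳ eq)

  restNeighbours : (v : W) → InRest cut v → RestNeighboursAtLeast h cut v
  restNeighbours (x ∷ xs) v∈ with ≡-dec _≟ᶠ_ xs tail
  ... | yes refl = restNeighbours-withTail x v∈
  ... | no xs≢tail with any? (λ a → any? (λ j → ≡-dec _≟ᶠ_ xs (tail [ j ]≔ symA a)))
  ...   | yes (a , j , refl) = restNeighbours-swappedTail x a j v∈
  ...   | no xs≢swapped      =
    restNeighbours-otherTail x xs v∈ xs≢tail (λ a j eq → xs≢swapped (a , j , eq))

  cut-isHCut : Fin K → Fin (h + e) → IsHCut h cut
  cut-isHCut j c = IsVertex-cut , cut-unique , disconnected j c , minDegreeAtLeast restNeighbours

sizedHCut : ∀ h e K′ → Fin (h + e) →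
  Σ (List (Word (suc h + e + suc K′) (suc (suc K′)))) λ S →
    IsHCut h S × length S ≡ h + e + suc K′ + h * K′
sizedHCut h e K′ c = cut , cut-isHCut zero c , trans length-cut (size h e K′)
  where
  open Construction h e (suc K′)
  size : ∀ h e K′ → e + suc h * suc K′ ≡ h + e + suc K′ + h * K′
  size = solve-∀

lemma3p1 : (n k h : ℕ) → 2 ≤ k → k ≤ n ∸ 1 → h ≤ n ∸ k →
    Σ (List (Word n k)) λ S → IsHCut h S × length S ≡ n + h * (k ∸ 2) ∸ 1
lemma3p1 zero (suc (suc K′)) h (s≤s (s≤s z≤n)) () h≤n-k
lemma3p1 n@(suc n′) k@(suc (suc K′)) h (s≤s (s≤s z≤n)) k≤n′ h≤n-k =
  subst (λ m → Σ (List (Word m k)) λ S → IsHCut h S × length S ≡ m + h * (k ∸ 2) ∸ 1)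
    size≡n (sizedHCut h e K′ c)
  where
  e : ℕ
  e = n ∸ k ∸ h

  h+e≡n-k : h + e ≡ n ∸ k
  h+e≡n-k = m+[n∸m]≡n h≤n-k

  c : Fin (h + e)
  c = subst Fin (sym (trans h+e≡n-k (+-∸-assoc 1 k≤n′))) zero

  size≡n : suc h + e + suc K′ ≡ n
  size≡n = begin
    suc (h + e + suc K′) ≡⟨ +-suc (h + e) (suc K′) ⟨
    h + e + k            ≡⟨ cong (_+ k) h+e≡n-k ⟩
    n ∸ k + k            ≡⟨ m∸n+n≡m (m≤n⇒m≤1+n k≤n′) ⟩
    n                    ∎
    where open ≡-Reasoning
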